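{- If $H$ is a snipped subgraph of a finite simple graph $G$ and $d(H)=\infty$, then $d(G)=\infty$.
   Context: The jump graph $J(G)$ has vertex set $E(G)$, two vertices adjacent iff the corresponding edges of $G$ share no endpoint; $J^0(G)=G$, $J^k(G)=J(J^{k-1}(G))$. The dissipation number $d(G)$ is the smallest $k\ge0$ with $J^k(G)$ the empty graph (no vertices), or $\infty$ if none exists. A quotient graph $Q$ of $G$ is obtained from a partition of $V(G)$: its vertices are the classes $[v]$, and $\{[u],[v]\}\in E(Q)$ iff $[u]\neq[v]$ and there is an edge $\{u',v'\}\in E(G)$ with $u'\in[u]$, $v'\in[v]$. A snipped subgraph of $G$ is a quotient graph of a subgraph of $G$. -}

module Defs where

open import Data.Nat using (ℕ; zero; suc)
open import Data.Fin using (Fin)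
open import Data.Bool using (Bool; true)
open import Data.Product using (Σ; _×_; _,_; proj₁; proj₂)
open import Data.Sum using (_⊎_; inj₁; inj₂)
open import Data.Empty using (⊥)
open import Relation.Nullary using (¬_; Dec)
open import Relation.Binary.PropositionalEquality using (_≡_; refl; sym; trans)

-- This is the ambient
-- notion used to iterate the jump graph: the vertices of J(G) are the
-- edges of G, i.e. unordered pairs {u,v}, represented as ordered
-- adjacent pairs (u , v) up to swapping (the setoid equality).

record SGraph : Set₁ where
  field
    V      : Set
    _≈_    : V → V → Set
    ≈-refl  : ∀ {x} → x ≈ x
    ≈-sym   : ∀ {x y} → x ≈ y → y ≈ x
    ≈-trans : ∀ {x y z} → x ≈ y → y ≈ z → x ≈ z
    Adj    : V → V → Set
    Adj-sym    : ∀ {x y} → Adj x y → Adj y x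
    Adj-irrefl : ∀ {x y} → Adj x y → ¬ (x ≈ y)
    Adj-resp   : ∀ {x x' y y'} → x ≈ x' → y ≈ y' → Adj x y → Adj x' y'

open SGraph

module _ (G : SGraph) where
  private
    module G = SGraph G

  Edge : Set
  Edge = Σ (G.V × G.V) λ p → G.Adj (proj₁ p) (proj₂ p)

  _≈E_ : Edge → Edge → Set
  ((u , v) , _) ≈E ((u' , v') , _) =
    (u G.≈ u' × v G.≈ v') ⊎ (u G.≈ v' × v G.≈ u')

  Share : Edge → Edge → Set
  Share ((u , v) , _) ((u' , v') , _) =
    (u G.≈ u') ⊎ (u G.≈ v') ⊎ (v G.≈ u') ⊎ (v G.≈ v')

  private
    ≈E-refl : ∀ {e} → e ≈E e
    ≈E-refl = inj₁ (G.≈-refl , G.≈-refl)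

    ≈E-sym : ∀ {e f} → e ≈E f → f ≈E e
    ≈E-sym (inj₁ (a , b)) = inj₁ (G.≈-sym a , G.≈-sym b)
    ≈E-sym (inj₂ (a , b)) = inj₂ (G.≈-sym b , G.≈-sym a)

    ≈E-trans : ∀ {e f g} → e ≈E f → f ≈E g → e ≈E g
    ≈E-trans (inj₁ (a , b)) (inj₁ (c , d)) = inj₁ (G.≈-trans a c , G.≈-trans b d)
    ≈E-trans (inj₁ (a , b)) (inj₂ (c , d)) = inj₂ (G.≈-trans a c , G.≈-trans b d)
    ≈E-trans (inj₂ (a , b)) (inj₁ (c , d)) = inj₂ (G.≈-trans a d , G.≈-trans b c)
    ≈E-trans (inj₂ (a , b)) (inj₂ (c , d)) = inj₁ (G.≈-trans a d , G.≈-trans b c)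

    Share-sym : ∀ {e f} → Share e f → Share f e
    Share-sym (inj₁ a) = inj₁ (G.≈-sym a)
    Share-sym (inj₂ (inj₁ a)) = inj₂ (inj₂ (inj₁ (G.≈-sym a)))
    Share-sym (inj₂ (inj₂ (inj₁ a))) = inj₂ (inj₁ (G.≈-sym a))
    Share-sym (inj₂ (inj₂ (inj₂ a))) = inj₂ (inj₂ (inj₂ (G.≈-sym a)))

    Share-resp : ∀ {e e' f f'} → e ≈E e' → f ≈E f' → Share e' f' → Share e f
    Share-resp {e} {e'} {f} {f'} p q s = go p q s
      where
      T = G.≈-trans
      S = G.≈-sym
      go : e ≈E e' → f ≈E f' → Share e' f' → Share e f
      go (inj₁ (a , b)) (inj₁ (c , d)) (inj₁ x) = inj₁ (T a (T x (S c)))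
      go (inj₁ (a , b)) (inj₁ (c , d)) (inj₂ (inj₁ x)) = inj₂ (inj₁ (T a (T x (S d))))
      go (inj₁ (a , b)) (inj₁ (c , d)) (inj₂ (inj₂ (inj₁ x))) = inj₂ (inj₂ (inj₁ (T b (T x (S c)))))
      go (inj₁ (a , b)) (inj₁ (c , d)) (inj₂ (inj₂ (inj₂ x))) = inj₂ (inj₂ (inj₂ (T b (T x (S d)))))
      go (inj₁ (a , b)) (inj₂ (c , d)) (inj₁ x) = inj₂ (inj₁ (T a (T x (S d))))
      go (inj₁ (a , b)) (inj₂ (c , d)) (inj₂ (inj₁ x)) = inj₁ (T a (T x (S c)))
      go (inj₁ (a , b)) (inj₂ (c , d)) (inj₂ (inj₂ (inj₁ x))) = inj₂ (inj₂ (inj₂ (T b (T x (S d)))))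
      go (inj₁ (a , b)) (inj₂ (c , d)) (inj₂ (inj₂ (inj₂ x))) = inj₂ (inj₂ (inj₁ (T b (T x (S c)))))
      go (inj₂ (a , b)) (inj₁ (c , d)) (inj₁ x) = inj₂ (inj₂ (inj₁ (T b (T x (S c)))))
      go (inj₂ (a , b)) (inj₁ (c , d)) (inj₂ (inj₁ x)) = inj₂ (inj₂ (inj₂ (T b (T x (S d)))))
      go (inj₂ (a , b)) (inj₁ (c , d)) (inj₂ (inj₂ (inj₁ x))) = inj₁ (T a (T x (S c)))
      go (inj₂ (a , b)) (inj₁ (c , d)) (inj₂ (inj₂ (inj₂ x))) = inj₂ (inj₁ (T a (T x (S d))))
      go (inj₂ (a , b)) (inj₂ (c , d)) (inj₁ x) = inj₂ (inj₂ (inj₂ (T b (T x (S d)))))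
      go (inj₂ (a , b)) (inj₂ (c , d)) (inj₂ (inj₁ x)) = inj₂ (inj₂ (inj₁ (T b (T x (S c)))))
      go (inj₂ (a , b)) (inj₂ (c , d)) (inj₂ (inj₂ (inj₁ x))) = inj₂ (inj₁ (T a (T x (S d))))
      go (inj₂ (a , b)) (inj₂ (c , d)) (inj₂ (inj₂ (inj₂ x))) = inj₁ (T a (T x (S c)))

    eq⇒share : ∀ {e f} → e ≈E f → Share e f
    eq⇒share (inj₁ (a , b)) = inj₁ a
    eq⇒share (inj₂ (a , b)) = inj₂ (inj₁ a)

  J : SGraph
  J = record
    { V = Edge
    ; _≈_ = _≈E_
    ; ≈-refl = λ {e} → ≈E-refl {e}
    ; ≈-sym = λ {e} {f} → ≈E-sym {e} {f}
    ; ≈-trans = λ {e} {f} {g} → ≈E-trans {e} {f} {g}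
    ; Adj = λ e f → ¬ Share e f
    ; Adj-sym = λ {e} {f} ns s → ns (Share-sym {f} {e} s)
    ; Adj-irrefl = λ {e} {f} ns eq → ns (eq⇒share {e} {f} eq)
    ; Adj-resp = λ {e} {e'} {f} {f'} p q ns s → ns (Share-resp {e} {e'} {f} {f'} p q s)
    }

J^ : ℕ → SGraph → SGraph
J^ zero    G = G
J^ (suc k) G = J (J^ k G)

IsEmptyGraph : SGraph → Set
IsEmptyGraph G = ¬ (V G)

DissInfinite : SGraph → Set
DissInfinite G = ∀ (k : ℕ) → ¬ IsEmptyGraph (J^ k G)

record FinGraph (n : ℕ) : Set₁ where
  field
    Adj        : Fin n → Fin n → Set
    Adj-dec    : ∀ i j → Dec (Adj i j)
    Adj-sym    : ∀ {i j} → Adj i j → Adj j i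
    Adj-irrefl : ∀ {i} → ¬ Adj i i

toSGraph : ∀ {n} → FinGraph n → SGraph
toSGraph {n} G = record
  { V = Fin n
  ; _≈_ = _≡_
  ; ≈-refl = refl
  ; ≈-sym = sym
  ; ≈-trans = trans
  ; Adj = FinGraph.Adj G
  ; Adj-sym = FinGraph.Adj-sym G
  ; Adj-irrefl = λ a eq → FinGraph.Adj-irrefl G (subst' eq a)
  ; Adj-resp = λ { refl refl a → a }
  }
  where
  subst' : ∀ {i j} → i ≡ j → FinGraph.Adj G i j → FinGraph.Adj G i i
  subst' refl a = a

record Subgraph {n : ℕ} (G : FinGraph n) : Set where
  field
    W      : Fin n → Bool
    F      : Fin n → Fin n → Bool
    F-sym  : ∀ {i j} → F i j ≡ true → F j i ≡ true
    F-edge : ∀ {i j} → F i j ≡ true → FinGraph.Adj G i j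
    F-left : ∀ {i j} → F i j ≡ true → W i ≡ true

-- Quotient graph of a subgraph S by the partition of W induced by a
-- labelling c : Fin n → Fin m (two vertices of W are in the same class
-- iff they have the same label; every partition of W arises this way).

module _ {n : ℕ} {G : FinGraph n} (S : Subgraph G) {m : ℕ} (c : Fin n → Fin m) where
  private
    module S = Subgraph S

  Class : Set
  Class = Σ (Fin m) λ k → Σ (Fin n) λ i → (S.W i ≡ true) × (c i ≡ k)

  QAdj : Class → Class → Set
  QAdj p q = (¬ proj₁ p ≡ proj₁ q) ×
             Σ (Fin n) λ i → Σ (Fin n) λ j →
               (S.F i j ≡ true) × (c i ≡ proj₁ p) × (c j ≡ proj₁ q)

  quotientGraph : SGraph
  quotientGraph = record
    { V = Class
    ; _≈_ = λ p q → proj₁ p ≡ proj₁ q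
    ; ≈-refl = refl
    ; ≈-sym = sym
    ; ≈-trans = trans
    ; Adj = QAdj
    ; Adj-sym = λ { (ne , i , j , f , a , b) → (λ e → ne (sym e)) , j , i , S.F-sym f , b , a }
    ; Adj-irrefl = proj₁
    ; Adj-resp = λ { p q (ne , i , j , f , a , b) →
        (λ e → ne (trans p (trans e (sym q)))) , i , j , f , trans a p , trans b q }
    }

{-# OPTIONS --safe #-}
module Submission where

open import Defs
open import Data.Nat using (ℕ; zero; suc)
open import Data.Fin using (Fin)
open import Data.Bool using (Bool; true; false; _xor_)
open import Data.Bool.Properties using (xor-assoc; xor-same)
open import Data.Product using (Σ; _×_; _,_; proj₁)
open import Data.Sum using (inj₁; inj₂)
open import Relation.Nullary using (¬_)
open import Relation.Binary.PropositionalEquality using (_≡_; refl; sym; trans; cong; subst)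

-- Call H a snipping of G if some partial map from the vertices of G
-- onto those of H lifts every edge of H to an edge of G.  Then J(H) is a snipping
-- of J(G): an edge of H lifts to an edge of G, and lifts of two disjoint edges of
-- H are disjoint, since a common endpoint would map to a common endpoint.  By
-- induction J^k(H) is a snipping of J^k(G), so J^k(G) = ∅ forces J^k(H) = ∅.

open SGraph

-- The map is a relation because it is only defined on the retained vertices.
record Snipping (H G : SGraph) : Set₁ where
  infix 4 _↦_
  field
    _↦_        : V G → V H → Set
    functional : ∀ {x y h g} → _≈_ G x y → x ↦ h → y ↦ g → _≈_ H h g
    surjective : ∀ h → Σ (V G) λ x → x ↦ h
    lift-Adj   : ∀ {h g} → Adj H h g → Σ (V G) λ x → Σ (V G) λ y → Adj G x y × x ↦ h × y ↦ g

endpoint : (G : SGraph) → Edge G → Bool → V G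
endpoint G ((u , v) , _) false = u
endpoint G ((u , v) , _) true  = v

record Matched (G H : SGraph) (P : V G → V H → Set) (e : Edge G) (f : Edge H) : Set where
  constructor _,_
  field
    swap  : Bool
    match : ∀ i → P (endpoint G e i) (endpoint H f (swap xor i))

xor-cancelˡ : ∀ b i → b xor (b xor i) ≡ i
xor-cancelˡ b i = trans (sym (xor-assoc b b i)) (cong (_xor i) (xor-same b))

module _ {G H : SGraph} {P : V G → V H → Set} where

  Matched-flip : {Q : V H → V G → Set} → (∀ {x y} → P x y → Q y x) →
    ∀ {e f} → Matched G H P e f → Matched H G Q f e
  Matched-flip {Q} flip {e} {f} (b , m) = b , λ i →
    subst (λ j → Q (endpoint H f j) (endpoint G e (b xor i))) (xor-cancelˡ b i)
      (flip (m (b xor i)))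

  Matched-compose : {K : SGraph} {Q : V H → V K → Set} {T : V G → V K → Set} →
    (∀ {x y z} → P x y → Q y z → T x z) →
    ∀ {e f g} → Matched G H P e f → Matched H K Q f g → Matched G K T e g
  Matched-compose {K} {T = T} comp {e} {f} {g} (b , m) (c , n) = c xor b , λ i →
    subst (λ j → T (endpoint G e i) (endpoint K g j)) (sym (xor-assoc c b i))
      (comp (m i) (n (b xor i)))

≈E⇒Matched : (G : SGraph) {e f : Edge G} → _≈E_ G e f → Matched G G (_≈_ G) e f
≈E⇒Matched G {(_ , _) , _} {(_ , _) , _} (inj₁ (p , q)) = false , λ { false → p ; true → q }
≈E⇒Matched G {(_ , _) , _} {(_ , _) , _} (inj₂ (p , q)) = true  , λ { false → p ; true → q }

Matched⇒≈E : (G : SGraph) {e f : Edge G} → Matched G G (_≈_ G) e f → _≈E_ G e f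
Matched⇒≈E G {(_ , _) , _} {(_ , _) , _} (false , m) = inj₁ (m false , m true)
Matched⇒≈E G {(_ , _) , _} {(_ , _) , _} (true  , m) = inj₂ (m false , m true)

Share⇒endpoint≈ : (G : SGraph) {e f : Edge G} → Share G e f →
  Σ Bool λ i → Σ Bool λ j → _≈_ G (endpoint G e i) (endpoint G f j)
Share⇒endpoint≈ G {(_ , _) , _} {(_ , _) , _} (inj₁ p)               = false , false , p
Share⇒endpoint≈ G {(_ , _) , _} {(_ , _) , _} (inj₂ (inj₁ p))        = false , true  , p
Share⇒endpoint≈ G {(_ , _) , _} {(_ , _) , _} (inj₂ (inj₂ (inj₁ p))) = true  , false , p
Share⇒endpoint≈ G {(_ , _) , _} {(_ , _) , _} (inj₂ (inj₂ (inj₂ p))) = true  , true  , p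

endpoint≈⇒Share : (G : SGraph) {e f : Edge G} (i j : Bool) →
  _≈_ G (endpoint G e i) (endpoint G f j) → Share G e f
endpoint≈⇒Share G {(_ , _) , _} {(_ , _) , _} false false p = inj₁ p
endpoint≈⇒Share G {(_ , _) , _} {(_ , _) , _} false true  p = inj₂ (inj₁ p)
endpoint≈⇒Share G {(_ , _) , _} {(_ , _) , _} true  false p = inj₂ (inj₂ (inj₁ p))
endpoint≈⇒Share G {(_ , _) , _} {(_ , _) , _} true  true  p = inj₂ (inj₂ (inj₂ p))

Snipping-J : ∀ {H G} → Snipping H G → Snipping (J H) (J G)
Snipping-J {H} {G} s = record
  { _↦_        = Matched G H _↦_
  ; functional = functional′
  ; surjective = surjective′
  ; lift-Adj   = lift-Adj′
  }
  where
  open Snipping s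

  functional′ : ∀ {e e′ f f′} → _≈E_ G e e′ →
    Matched G H _↦_ e f → Matched G H _↦_ e′ f′ → _≈E_ H f f′
  functional′ {e} {e′} {f} {f′} e≈e′ e↦f e′↦f′ = Matched⇒≈E H f≈f′
    where
    Pre : V H → V G → Set
    Pre h y = Σ (V G) λ x → x ↦ h × _≈_ G x y

    f-Pre-e′ : Matched H G Pre f e′
    f-Pre-e′ = Matched-compose (λ x↦h x≈y → _ , x↦h , x≈y)
      (Matched-flip (λ x↦h → x↦h) e↦f) (≈E⇒Matched G e≈e′)

    f≈f′ : Matched H H (_≈_ H) f f′
    f≈f′ = Matched-compose (λ { (x , x↦h , x≈y) y↦h′ → functional x≈y x↦h y↦h′ }) f-Pre-e′ e′↦f′

  surjective′ : ∀ f → Σ (Edge G) λ e → Matched G H _↦_ e f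
  surjective′ ((h , g) , h~g) with lift-Adj h~g
  ... | x , y , x~y , x↦h , y↦g = ((x , y) , x~y) , false , λ { false → x↦h ; true → y↦g }

  lift-Adj′ : ∀ {f g} → ¬ Share H f g →
    Σ (Edge G) λ e₁ → Σ (Edge G) λ e₂ → ¬ Share G e₁ e₂ × Matched G H _↦_ e₁ f × Matched G H _↦_ e₂ g
  lift-Adj′ {f} {g} f#g with surjective′ f | surjective′ g
  ... | e₁ , e₁↦f | e₂ , e₂↦g = e₁ , e₂ , e₁#e₂ , e₁↦f , e₂↦g
    where
    open Matched
    e₁#e₂ : ¬ Share G e₁ e₂
    e₁#e₂ sh with Share⇒endpoint≈ G sh
    ... | i , j , p = f#g (endpoint≈⇒Share H (swap e₁↦f xor i) (swap e₂↦g xor j)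
                             (functional p (match e₁↦f i) (match e₂↦g j)))

Snipping-J^ : ∀ {H G} k → Snipping H G → Snipping (J^ k H) (J^ k G)
Snipping-J^ zero    s = s
Snipping-J^ (suc k) s = Snipping-J (Snipping-J^ k s)

Snipping-DissInfinite : ∀ {H G} → Snipping H G → DissInfinite H → DissInfinite G
Snipping-DissInfinite s dH k J^kG-empty =
  dH k (λ h → J^kG-empty (proj₁ (Snipping.surjective (Snipping-J^ k s) h)))

quotientGraph-Snipping : ∀ {n} {G : FinGraph n} (S : Subgraph G) {m} (c : Fin n → Fin m) →
  Snipping (quotientGraph S c) (toSGraph G)
quotientGraph-Snipping S c = record
  { _↦_        = λ x p → (W x ≡ true) × (c x ≡ proj₁ p)
  ; functional = λ { refl (_ , cx≡p) (_ , cx≡q) → trans (sym cx≡p) cx≡q }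
  ; surjective = λ { (_ , i , i∈W , ci≡k) → i , i∈W , ci≡k }
  ; lift-Adj   = λ { (_ , i , j , ij∈F , ci≡p , cj≡q) →
      i , j , F-edge ij∈F , (F-left ij∈F , ci≡p) , (F-left (F-sym ij∈F) , cj≡q) }
  }
  where open Subgraph S

mainTheorem6 : ∀ (n : ℕ) (G : FinGraph n) (S : Subgraph G) (m : ℕ) (c : Fin n → Fin m) →
    DissInfinite (quotientGraph S c) → DissInfinite (toSGraph G)
mainTheorem6 n G S m c = Snipping-DissInfinite (quotientGraph-Snipping S c)
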